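{- Let $G=(V,E)$ be a connected chordal claw-free graph with (unique) clique tree $T_G=(\mathcal M,\mathcal E)$, and let $B\in\mathcal M$. If the degree of $B$ in $T_G$ is at least 3, then $B$ is a star clique or a fork clique.
   Context: Graphs are finite simple undirected. A graph is chordal if every cycle of length at least 4 has a chord, and claw-free if it has no induced $K_{1,3}$. A max clique is an inclusion-maximal clique; $\mathcal M$ is the set of max cliques and $\mathcal M_v$ the set of max cliques containing $v$. A clique tree is a tree on $\mathcal M$ in which each $T[\mathcal M_v]$ is connected; a connected chordal claw-free graph has exactly one clique tree $T_G$, and each $T_G[\mathcal M_v]$ is a path. A max clique $B$ is a star clique if for every $v\in B$, $B$ is an end of the path $T_G[\mathcal M_v]$. A max clique $B$ of degree 3 in $T_G$ is a fork clique if (i) for every $v\in B$ there are two distinct neighbours $A,A'$ of $B$ in $T_G$ with $\mathcal M_v=\{B,A,A'\}$, and (ii) for all distinct neighbours $A,A'$ of $B$ in $T_G$ there is $v\in B$ with $\mathcal M_v=\{B,A,A'\}$. -}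

module Defs where

open import Data.Nat using (ℕ; zero; suc; _≤_)
open import Data.Nat.DivMod using (_mod_)
open import Data.Fin using (Fin; toℕ)
open import Data.Fin.Subset using (Subset; _∈_; _∉_; _⊆_)
open import Data.Product using (Σ; ∃; ∃-syntax; _×_; _,_)
open import Data.Sum using (_⊎_)
open import Data.Empty using (⊥)
open import Relation.Nullary using (¬_; Dec)
open import Relation.Binary.PropositionalEquality using (_≡_; _≢_)
open import Relation.Binary.Construct.Closure.ReflexiveTransitive using (Star)
open import Function.Definitions using (Injective)

next : ∀ {k} → Fin k → Fin k
next {suc k} i = suc (toℕ i) mod suc k

record Graph (n : ℕ) : Set₁ where
  field
    Adj     : Fin n → Fin n → Set
    adj?    : ∀ u v → Dec (Adj u v)
    sym     : ∀ {u v} → Adj u v → Adj v u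
    irrefl  : ∀ {u} → ¬ Adj u u

module _ {n : ℕ} (G : Graph n) where
  open Graph G

  Connected : Set
  Connected = ∀ u v → Star Adj u v

  Chordal : Set
  Chordal = ∀ k → 4 ≤ k → (c : Fin k → Fin n) → Injective _≡_ _≡_ c →
            (∀ i → Adj (c i) (c (next i))) →
            ∃[ i ] ∃[ j ] (Adj (c i) (c j) × i ≢ j × j ≢ next i × i ≢ next j)

  ClawFree : Set
  ClawFree = ¬ (∃[ a ] ∃[ b ] ∃[ c ] ∃[ d ]
    (Adj a b × Adj a c × Adj a d × b ≢ c × b ≢ d × c ≢ d ×
     ¬ Adj b c × ¬ Adj b d × ¬ Adj c d))

  IsClique : Subset n → Set
  IsClique S = ∀ {u v} → u ∈ S → v ∈ S → u ≢ v → Adj u v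

  IsMaxClique : Subset n → Set
  IsMaxClique S = IsClique S × (∀ S′ → IsClique S′ → S ⊆ S′ → S′ ≡ S)

  record CliqueTree : Set₁ where
    field
      TE        : Subset n → Subset n → Set
      TE-max    : ∀ {A C} → TE A C → IsMaxClique A × IsMaxClique C
      TE-sym    : ∀ {A C} → TE A C → TE C A
      TE-irrefl : ∀ {A} → ¬ TE A A
      TE-conn   : ∀ A C → IsMaxClique A → IsMaxClique C → Star TE A C
      TE-acyc   : ∀ k → 3 ≤ k → (c : Fin k → Subset n) → Injective _≡_ _≡_ c →
                  ¬ (∀ i → TE (c i) (c (next i)))
      running   : ∀ v A C → IsMaxClique A → IsMaxClique C → v ∈ A → v ∈ C →
                  Star (λ X Y → TE X Y × v ∈ X × v ∈ Y) A C

  module _ (T : CliqueTree) where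
    open CliqueTree T

    DegAtLeast3 : Subset n → Set
    DegAtLeast3 B = ∃[ A₁ ] ∃[ A₂ ] ∃[ A₃ ]
      (TE B A₁ × TE B A₂ × TE B A₃ × A₁ ≢ A₂ × A₁ ≢ A₃ × A₂ ≢ A₃)

    NeighboursExactly : Subset n → Subset n → Subset n → Subset n → Set
    NeighboursExactly B A₁ A₂ A₃ =
      TE B A₁ × TE B A₂ × TE B A₃ × A₁ ≢ A₂ × A₁ ≢ A₃ × A₂ ≢ A₃ ×
      (∀ C → TE B C → C ≡ A₁ ⊎ C ≡ A₂ ⊎ C ≡ A₃)

    -- B is an end of the path T[M_v]: v ∈ B and B has at most one
    -- neighbour in T[M_v]
    IsEndOf : Fin n → Subset n → Set
    IsEndOf v B = v ∈ B ×
      (∀ A A′ → TE B A → TE B A′ → v ∈ A → v ∈ A′ → A ≡ A′)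

    IsStarClique : Subset n → Set
    IsStarClique B = ∀ v → v ∈ B → IsEndOf v B

    MvIs : Fin n → Subset n → Subset n → Subset n → Set
    MvIs v B A A′ = ∀ C → ((IsMaxClique C × v ∈ C) → (C ≡ B ⊎ C ≡ A ⊎ C ≡ A′))
                        × ((C ≡ B ⊎ C ≡ A ⊎ C ≡ A′) → (IsMaxClique C × v ∈ C))

    IsForkClique : Subset n → Set
    IsForkClique B =
      (∃[ A₁ ] ∃[ A₂ ] ∃[ A₃ ] NeighboursExactly B A₁ A₂ A₃) ×
      (∀ v → v ∈ B → ∃[ A ] ∃[ A′ ] (TE B A × TE B A′ × A ≢ A′ × MvIs v B A A′)) ×
      (∀ A A′ → TE B A → TE B A′ → A ≢ A′ → ∃[ v ] (v ∈ B × MvIs v B A A′))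

-- Removing a max clique Z from the tree T splits it into branches, one for
-- each neighbour of Z.  Running intersection (each T[M_v] is connected) and
-- acyclicity give the basic separation facts: a vertex of a neighbour X of Z
-- lying in a max clique of X's branch lies in X, and vertices outside Z in
-- different branches are distinct and non-adjacent.  Together with
-- claw-freeness this says that no vertex of Z lies in three neighbours, and
-- that once some vertex of Z lies in two neighbours X, Y, every vertex of Z
-- lies in X or in Y.
--
-- If no vertex of B lies in two neighbours, B is
-- a star clique.  Otherwise a vertex v ∈ B ∩ A ∩ A′ and a third neighbour D
-- produce three neighbours X, Y, W of B that pairwise share a vertex of B;
-- from this "triangle" one reads off that B has exactly these three
-- neighbours, that every vertex of B lies in exactly two of them, and that
-- M_u = {B, X, Y} for u ∈ B ∩ X ∩ Y: B is a fork clique.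
module Submission where

open import Defs
open import Data.Nat using (ℕ; zero; suc; _≤_; _<_; s≤s; z≤n)
open import Data.Nat.Properties using (≤∧≢⇒<) renaming (_≟_ to _≟ℕ_)
open import Data.Nat.DivMod using (_%_; m<n⇒m%n≡m; n%n≡0)
open import Data.Fin using (Fin; toℕ) renaming (_≟_ to _≟F_)
open import Data.Fin.Properties using (toℕ-fromℕ<; toℕ<n; toℕ-injective; any?; all?)
open import Data.Fin.Subset using (Subset; _∈_; _∉_; _⊆_; _∪_; ⁅_⁆)
open import Data.Fin.Subset.Properties
  using (_∈?_; x∈p∪q⁺; x∈p∪q⁻; x∈⁅x⁆; x∈⁅y⁆⇒x≡y; ⊆-antisym)
open import Data.Bool using () renaming (_≟_ to _≟B_)
open import Data.Vec.Properties using (≡-dec)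
open import Data.List using (List; []; _∷_; length; allFin)
open import Data.List.Membership.Propositional using () renaming (_∈_ to _∈ₗ_; _∉_ to _∉ₗ_)
open import Data.List.Membership.Propositional.Properties using (∈-allFin)
open import Data.List.Relation.Unary.Any using (here; there)
open import Data.List.Relation.Unary.All as All using (All)
open import Data.List.Relation.Unary.All.Properties using (¬Any⇒All¬)
open import Data.List.Relation.Unary.Unique.Propositional using (Unique)
open import Data.List.Relation.Unary.AllPairs as AllPairs using ()
open import Data.Product using (Σ; ∃; ∃-syntax; _×_; _,_; proj₁; proj₂)
open import Data.Sum using (_⊎_; inj₁; inj₂; [_,_]′)
open import Data.Empty using (⊥; ⊥-elim)
open import Function using (_∘_; id)
open import Function.Definitions using (Injective)
open import Relation.Nullary using (¬_; Dec; yes; no)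
open import Relation.Nullary.Decidable using (_×-dec_; _→-dec_; ¬?)
open import Relation.Binary.PropositionalEquality
  using (_≡_; _≢_; refl; sym; trans; cong; subst; ≢-sym)
open import Relation.Binary.Definitions using (DecidableEquality)
open import Relation.Binary.Construct.Closure.ReflexiveTransitive
  using (Star; ε; _◅_; _◅◅_; reverse) renaming (map to Star-map)

toℕ-next : ∀ {k} (i : Fin k) →
           toℕ (next i) ≡ suc (toℕ i) ⊎ (suc (toℕ i) ≡ k × toℕ (next i) ≡ 0)
toℕ-next {suc k} i with suc (toℕ i) ≟ℕ suc k
... | yes last = inj₂ (last , trans (toℕ-fromℕ< _) (trans (cong (_% suc k) last) (n%n≡0 (suc k))))
... | no ¬last = inj₁ (trans (toℕ-fromℕ< _) (m<n⇒m%n≡m (≤∧≢⇒< (toℕ<n i) ¬last)))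

module Walks {A : Set} (_≟_ : DecidableEquality A) where
  open import Data.List.Membership.DecPropositional _≟_ using () renaming (_∈?_ to _∈ₗ?_)

  -- Path R y x L: L lists, in order, the vertices of an R-walk from x to y
  -- with the final vertex y left out; a closed walk at h is a Path R h h L.
  data Path (R : A → A → Set) (y : A) : A → List A → Set where
    done : Path R y y []
    _▸_  : ∀ {x w L} → R x w → Path R y w L → Path R y x (x ∷ L)

  path-map : ∀ {R S : A → A → Set} → (∀ {a b} → R a b → S a b) →
             ∀ {y x L} → Path R y x L → Path S y x L
  path-map f done = done
  path-map f (r ▸ p) = f r ▸ path-map f p

  path-sources : ∀ {R : A → A → Set} {P : A → Set} → (∀ {a b} → R a b → P a) →
                 ∀ {y x L} → Path R y x L → All P L
  path-sources f done = All.[]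
  path-sources f (r ▸ p) = f r All.∷ path-sources f p

  vertexAt : A → List A → ℕ → A
  vertexAt y [] m = y
  vertexAt y (a ∷ L) zero = a
  vertexAt y (a ∷ L) (suc m) = vertexAt y L m

  vertexAt-last : ∀ y L → vertexAt y L (length L) ≡ y
  vertexAt-last y [] = refl
  vertexAt-last y (a ∷ L) = vertexAt-last y L

  vertexAt-∈ : ∀ y L m → m < length L → vertexAt y L m ∈ₗ L
  vertexAt-∈ y (a ∷ L) zero _ = here refl
  vertexAt-∈ y (a ∷ L) (suc m) (s≤s m<) = there (vertexAt-∈ y L m m<)

  vertexAt-injective : ∀ y L → Unique L → ∀ m m′ → m < length L → m′ < length L →
                       vertexAt y L m ≡ vertexAt y L m′ → m ≡ m′
  vertexAt-injective y (a ∷ L) (_ AllPairs.∷ _) zero zero _ _ _ = refl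
  vertexAt-injective y (a ∷ L) (a∉ AllPairs.∷ _) zero (suc m′) _ (s≤s m′<) e =
    ⊥-elim (All.lookup a∉ (vertexAt-∈ y L m′ m′<) e)
  vertexAt-injective y (a ∷ L) (a∉ AllPairs.∷ _) (suc m) zero (s≤s m<) _ e =
    ⊥-elim (All.lookup a∉ (vertexAt-∈ y L m m<) (sym e))
  vertexAt-injective y (a ∷ L) (_ AllPairs.∷ u) (suc m) (suc m′) (s≤s m<) (s≤s m′<) e =
    cong suc (vertexAt-injective y L u m m′ m< m′< e)

  module _ {R : A → A → Set} where
    vertexAt-head : ∀ {y w L} → Path R y w L → vertexAt y L 0 ≡ w
    vertexAt-head done = refl
    vertexAt-head (r ▸ p) = refl

    path-step : ∀ {y x L} → Path R y x L → ∀ m → suc m ≤ length L →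
                R (vertexAt y L m) (vertexAt y L (suc m))
    path-step (r ▸ p) zero _ = subst (R _) (sym (vertexAt-head p)) r
    path-step (r ▸ p) (suc m) (s≤s m<) = path-step p m m<

    closed-path⇒cycle : ∀ {h L} → Path R h h L → Unique L →
      Σ (Fin (length L) → A) λ c → Injective _≡_ _≡_ c × (∀ i → R (c i) (c (next i)))
    closed-path⇒cycle {h} {L} p u = c , c-injective , c-step
      where
      c : Fin (length L) → A
      c i = vertexAt h L (toℕ i)
      c-injective : Injective _≡_ _≡_ c
      c-injective {i} {j} e = toℕ-injective (vertexAt-injective h L u _ _ (toℕ<n i) (toℕ<n j) e)
      c-step : ∀ i → R (c i) (c (next i))
      c-step i with toℕ-next i
      ... | inj₁ succ = subst (λ m → R (c i) (vertexAt h L m)) (sym succ) (path-step p (toℕ i) (toℕ<n i))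
      ... | inj₂ (last , wrap) = subst (R (c i)) closes (path-step p (toℕ i) (toℕ<n i))
        where
        closes : vertexAt h L (suc (toℕ i)) ≡ c (next i)
        closes = trans (cong (vertexAt h L) last)
                   (trans (vertexAt-last h L)
                     (trans (sym (vertexAt-head p)) (cong (vertexAt h L) (sym wrap))))

    suffixFrom : ∀ {y w x L} → Path R y w L → x ∈ₗ L →
                 ∃ λ L′ → Path R y x L′ × (Unique L → Unique L′) × (y ∉ₗ L → y ∉ₗ L′)
    suffixFrom p@(_ ▸ _) (here refl) = _ , p , id , id
    suffixFrom (_ ▸ p) (there x∈) with suffixFrom p x∈
    ... | L′ , p′ , keepsUnique , keepsFresh =
      L′ , p′ , (λ { (_ AllPairs.∷ u) → keepsUnique u }) , (λ y∉ → keepsFresh (y∉ ∘ there))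

    simplify : ∀ {x y} → Star R x y → ∃ λ L → Path R y x L × Unique L × y ∉ₗ L
    simplify ε = [] , done , AllPairs.[] , λ ()
    simplify {x} {y} (r ◅ s) with simplify s
    ... | L , p , u , y∉ with x ≟ y
    ...   | yes refl = [] , done , AllPairs.[] , λ ()
    ...   | no x≢y with x ∈ₗ? L
    ...     | yes x∈ = let (L′ , p′ , keepsUnique , keepsFresh) = suffixFrom p x∈
                       in L′ , p′ , keepsUnique u , keepsFresh y∉
    ...     | no x∉ = x ∷ L , r ▸ p , ¬Any⇒All¬ L x∉ AllPairs.∷ u ,
                     λ { (here y≡x) → x≢y (sym y≡x) ; (there y∈) → y∉ y∈ }

module MaxCliques {n : ℕ} (G : Graph n) where
  open Graph G renaming (sym to Adj-sym)

  Compatible : Fin n → Subset n → Set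
  Compatible v S = ∀ {u} → u ∈ S → u ≢ v → Adj u v

  compatible? : ∀ v S → Dec (Compatible v S)
  compatible? v S with all? (λ u → u ∈? S →-dec (¬? (u ≟F v) →-dec adj? u v))
  ... | yes all = yes λ {u} → all u
  ... | no ¬all = no λ c → ¬all λ u → c

  add-compatible : ∀ {v S} → IsClique G S → Compatible v S → IsClique G (S ∪ ⁅ v ⁆)
  add-compatible {v} {S} clique compat {a} {b} a∈ b∈ a≢b
    with x∈p∪q⁻ S ⁅ v ⁆ a∈ | x∈p∪q⁻ S ⁅ v ⁆ b∈
  ... | inj₁ aS | inj₁ bS = clique aS bS a≢b
  ... | inj₁ aS | inj₂ bv rewrite x∈⁅y⁆⇒x≡y v bv = compat aS a≢b
  ... | inj₂ av | inj₁ bS rewrite x∈⁅y⁆⇒x≡y v av = Adj-sym (compat bS (≢-sym a≢b))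
  ... | inj₂ av | inj₂ bv = ⊥-elim (a≢b (trans (x∈⁅y⁆⇒x≡y v av) (sym (x∈⁅y⁆⇒x≡y v bv))))

  grow : List (Fin n) → Subset n → Subset n
  grow [] S = S
  grow (v ∷ vs) S with compatible? v S
  ... | yes _ = grow vs (S ∪ ⁅ v ⁆)
  ... | no _ = grow vs S

  grow-⊇ : ∀ vs S → S ⊆ grow vs S
  grow-⊇ [] S x∈ = x∈
  grow-⊇ (v ∷ vs) S x∈ with compatible? v S
  ... | yes _ = grow-⊇ vs _ (x∈p∪q⁺ (inj₁ x∈))
  ... | no _ = grow-⊇ vs S x∈

  grow-clique : ∀ vs S → IsClique G S → IsClique G (grow vs S)
  grow-clique [] S clique = clique
  grow-clique (v ∷ vs) S clique with compatible? v S
  ... | yes compat = grow-clique vs _ (add-compatible clique compat)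
  ... | no _ = grow-clique vs S clique

  grow-saturated : ∀ vs S {v} → v ∈ₗ vs → Compatible v (grow vs S) → v ∈ grow vs S
  grow-saturated (w ∷ vs) S (here refl) compat with compatible? w S
  ... | yes _ = grow-⊇ vs _ (x∈p∪q⁺ (inj₂ (x∈⁅x⁆ w)))
  ... | no incompat = ⊥-elim (incompat (λ uS → compat (grow-⊇ vs S uS)))
  grow-saturated (w ∷ vs) S (there v∈) compat with compatible? w S
  ... | yes _ = grow-saturated vs _ v∈ compat
  ... | no _ = grow-saturated vs S v∈ compat

  -- growing along all vertices yields a maximal clique: a clique S′ ⊇ C has
  -- only vertices compatible with C, and those were added
  maxClique-⊇ : ∀ S → IsClique G S → ∃ λ C → IsMaxClique G C × S ⊆ C
  maxClique-⊇ S clique = C , (grow-clique vs S clique , maximal) , grow-⊇ vs S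
    where
    vs : List (Fin n)
    vs = allFin n
    C : Subset n
    C = grow vs S
    maximal : ∀ S′ → IsClique G S′ → C ⊆ S′ → S′ ≡ C
    maximal S′ clique′ C⊆S′ = ⊆-antisym S′⊆C C⊆S′
      where
      S′⊆C : S′ ⊆ C
      S′⊆C {v} vS′ = grow-saturated vs S (∈-allFin v) (λ uC → clique′ (C⊆S′ uC) vS′)

  edge-clique : ∀ {a b} → Adj a b → IsClique G (⁅ a ⁆ ∪ ⁅ b ⁆)
  edge-clique {a} {b} ab = add-compatible singleton b-compatible
    where
    singleton : IsClique G ⁅ a ⁆
    singleton u∈ v∈ u≢v = ⊥-elim (u≢v (trans (x∈⁅y⁆⇒x≡y a u∈) (sym (x∈⁅y⁆⇒x≡y a v∈))))
    b-compatible : Compatible b ⁅ a ⁆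
    b-compatible u∈ _ rewrite x∈⁅y⁆⇒x≡y a u∈ = ab

  edge-maxClique : ∀ {a b} → Adj a b → ∃ λ K → IsMaxClique G K × a ∈ K × b ∈ K
  edge-maxClique {a} {b} ab with maxClique-⊇ (⁅ a ⁆ ∪ ⁅ b ⁆) (edge-clique ab)
  ... | K , maxK , ⊆K = K , maxK , ⊆K (x∈p∪q⁺ (inj₁ (x∈⁅x⁆ a))) , ⊆K (x∈p∪q⁺ (inj₂ (x∈⁅x⁆ b)))

module Branches {n : ℕ} (G : Graph n) (T : CliqueTree G) where
  open Graph G renaming (sym to Adj-sym)
  open CliqueTree T
  open MaxCliques G using (edge-maxClique)

  _≟S_ : DecidableEquality (Subset n)
  _≟S_ = ≡-dec _≟B_

  open Walks _≟S_

  Max : Subset n → Set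
  Max = IsMaxClique G

  max-left : ∀ {Z X} → TE Z X → Max Z
  max-left = proj₁ ∘ TE-max

  max-right : ∀ {Z X} → TE Z X → Max X
  max-right = proj₂ ∘ TE-max

  neighbour-≢ : ∀ {Z X} → TE Z X → X ≢ Z
  neighbour-≢ t refl = TE-irrefl t

  Avoiding : Subset n → Subset n → Subset n → Set
  Avoiding Z X Y = TE X Y × X ≢ Z × Y ≢ Z

  SameBranch : Subset n → Subset n → Subset n → Set
  SameBranch Z = Star (Avoiding Z)

  sameBranch-sym : ∀ {Z X Y} → SameBranch Z X Y → SameBranch Z Y X
  sameBranch-sym = reverse (λ { (t , X≢Z , Y≢Z) → TE-sym t , Y≢Z , X≢Z })

  sameBranch-end : ∀ {Z X K} → SameBranch Z X K → X ≢ Z → K ≢ Z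
  sameBranch-end ε X≢Z = X≢Z
  sameBranch-end ((_ , _ , Y≢Z) ◅ w) _ = sameBranch-end w Y≢Z

  no-simple-cycle : ∀ {h L} → Path TE h h L → Unique L → 3 ≤ length L → ⊥
  no-simple-cycle p u long with closed-path⇒cycle p u
  ... | c , c-injective , c-step = TE-acyc _ long c c-injective c-step

  branch-neighbour-unique : ∀ {Z P Q} → TE Z P → TE Z Q → SameBranch Z P Q → P ≡ Q
  branch-neighbour-unique {Z} {P} {Q} zp zq w with P ≟S Q
  ... | yes P≡Q = P≡Q
  ... | no P≢Q with simplify w
  ...   | [] , done , _ , _ = ⊥-elim (P≢Q refl)
  ...   | (.P ∷ L) , (r ▸ p) , u , Q∉ = ⊥-elim (no-simple-cycle closed unique (s≤s (s≤s (s≤s z≤n))))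
    where
    inBranch : Path (Avoiding Z) Q P (P ∷ L)
    inBranch = r ▸ p
    closed : Path TE Q Q (Q ∷ Z ∷ P ∷ L)
    closed = TE-sym zq ▸ (zp ▸ path-map proj₁ inBranch)
    Z∉ : All (Z ≢_) (P ∷ L)
    Z∉ = path-sources (≢-sym ∘ proj₁ ∘ proj₂) inBranch
    unique : Unique (Q ∷ Z ∷ P ∷ L)
    unique = (neighbour-≢ zq All.∷ ¬Any⇒All¬ _ Q∉) AllPairs.∷ (Z∉ AllPairs.∷ u)

  -- A walk from Z to K ≠ Z in T leaves Z for the last time through a
  -- neighbour X of Z in K's branch.
  module _ {R : Subset n → Subset n → Set} (R⊆TE : ∀ {a b} → R a b → TE a b) where
    exit′ : ∀ {Z S K} → Star R S K → K ≢ Z →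
            (∃ λ X → R Z X × SameBranch Z X K) ⊎ (S ≢ Z × SameBranch Z S K)
    exit′ ε K≢Z = inj₂ (K≢Z , ε)
    exit′ {Z} {S} (r ◅ s) K≢Z with exit′ s K≢Z
    ... | inj₁ exits = inj₁ exits
    ... | inj₂ (Y≢Z , w) with S ≟S Z
    ...   | yes refl = inj₁ (_ , r , w)
    ...   | no S≢Z = inj₂ (S≢Z , (R⊆TE r , S≢Z , Y≢Z) ◅ w)

    exit : ∀ {Z K} → Star R Z K → K ≢ Z → ∃ λ X → R Z X × SameBranch Z X K
    exit s K≢Z with exit′ s K≢Z
    ... | inj₁ exits = exits
    ... | inj₂ (Z≢Z , _) = ⊥-elim (Z≢Z refl)

  sharing⇒sameBranch : ∀ {u Z P Q} → u ∉ Z → Max P → Max Q → u ∈ P → u ∈ Q → SameBranch Z P Q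
  sharing⇒sameBranch {u} {Z} u∉Z maxP maxQ uP uQ =
    Star-map (λ { (t , uX , uY) → t , avoid uX , avoid uY }) (running u _ _ maxP maxQ uP uQ)
    where
    avoid : ∀ {X} → u ∈ X → X ≢ Z
    avoid uX refl = u∉Z uX

  branch-contains : ∀ {Z X K w} → TE Z X → w ∈ Z → Max K → w ∈ K → SameBranch Z X K → w ∈ X
  branch-contains {Z} {K = K} {w} zx wZ maxK wK XK
    with exit proj₁ (running w Z K (max-left zx) maxK wZ wK) (sameBranch-end XK (neighbour-≢ zx))
  ... | X′ , (zx′ , _ , wX′) , X′K =
    subst (w ∈_) (branch-neighbour-unique zx′ zx (X′K ◅◅ sameBranch-sym XK)) wX′

  branches-exclusive : ∀ {Z X C} → TE Z X → SameBranch Z X C → SameBranch X Z C → C ≢ X → ⊥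
  branches-exclusive zx XC ZC C≢X with exit proj₁ XC C≢X
  ... | X′ , (xx′ , _ , X′≢Z) , X′C =
    X′≢Z (branch-neighbour-unique xx′ (TE-sym zx) (X′C ◅◅ sameBranch-sym ZC))

  -- a neighbour X of Z has a vertex outside Z, since both are maximal
  private-vertex : ∀ {Z X} → TE Z X → ∃ λ x → x ∈ X × x ∉ Z
  private-vertex {Z} {X} zx with any? (λ x → (x ∈? X) ×-dec ¬? (x ∈? Z))
  ... | yes found = found
  ... | no none = ⊥-elim (TE-irrefl (subst (TE Z) (sym Z≡X) zx))
    where
    X⊆Z : X ⊆ Z
    X⊆Z {x} xX with x ∈? Z
    ... | yes xZ = xZ
    ... | no x∉Z = ⊥-elim (none (x , xX , x∉Z))
    Z≡X : Z ≡ X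
    Z≡X = proj₂ (max-right zx) Z (proj₁ (max-left zx)) X⊆Z

  absorb : ∀ {Z X w x} → TE Z X → w ∈ Z → x ∈ X → x ∉ Z → Adj w x → w ∈ X
  absorb zx wZ xX x∉Z wx with edge-maxClique wx
  ... | K , maxK , wK , xK =
    branch-contains zx wZ maxK wK (sharing⇒sameBranch x∉Z (max-right zx) maxK xX xK)

  Independent : Fin n → Fin n → Set
  Independent p q = ¬ Adj p q × p ≢ q

  ∈∉⇒≢ : ∀ {a b : Fin n} {S} → a ∈ S → b ∉ S → a ≢ b
  ∈∉⇒≢ aS b∉S refl = b∉S aS

  separated : ∀ {Z X Y P Q p q} → TE Z X → TE Z Y → X ≢ Y →
              p ∉ Z → Max P → p ∈ P → SameBranch Z X P →
              q ∉ Z → Max Q → q ∈ Q → SameBranch Z Y Q → Independent p q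
  separated {Z} {P = P} {Q} {p} {q} zx zy X≢Y p∉Z maxP pP XP q∉Z maxQ qQ YQ = non-adjacent , distinct
    where
    joined : SameBranch Z P Q → ⊥
    joined PQ = X≢Y (branch-neighbour-unique zx zy (XP ◅◅ PQ ◅◅ sameBranch-sym YQ))
    non-adjacent : ¬ Adj p q
    non-adjacent pq with edge-maxClique pq
    ... | K , maxK , pK , qK =
      joined (sharing⇒sameBranch p∉Z maxP maxK pP pK ◅◅ sharing⇒sameBranch q∉Z maxK maxQ qK qQ)
    distinct : p ≢ q
    distinct refl = joined (sharing⇒sameBranch p∉Z maxP maxQ pP qQ)

  separated-private : ∀ {Z X Y p q} → TE Z X → TE Z Y → X ≢ Y →
                      p ∈ X → p ∉ Z → q ∈ Y → q ∉ Z → Independent p q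
  separated-private zx zy X≢Y pX p∉Z qY q∉Z =
    separated zx zy X≢Y p∉Z (max-right zx) pX ε q∉Z (max-right zy) qY ε

  separated-from-Z : ∀ {Z X w x} → TE Z X → w ∈ Z → w ∉ X → x ∈ X → x ∉ Z → Independent x w
  separated-from-Z zx wZ w∉X xX x∉Z = (λ xw → w∉X (absorb zx wZ xX x∉Z (Adj-sym xw))) , ∈∉⇒≢ xX w∉X

  shared⇒inside : ∀ {Z X Y u} → TE Z X → TE Z Y → X ≢ Y → u ∈ X → u ∈ Y → u ∈ Z
  shared⇒inside {Z} {u = u} zx zy X≢Y uX uY with u ∈? Z
  ... | yes uZ = uZ
  ... | no u∉Z = ⊥-elim (X≢Y (branch-neighbour-unique zx zy
                          (sharing⇒sameBranch u∉Z (max-right zx) (max-right zy) uX uY)))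

  adj-in : ∀ {X a b} → Max X → a ∈ X → b ∈ X → a ≢ b → Adj a b
  adj-in maxX = proj₁ maxX

  -- In a connected graph adjacent max cliques share a vertex: follow a path
  -- from a private vertex of X to a vertex of Z; the first vertex on it in Z
  -- lies in X.
  adjacent-meet : Connected G → ∀ {Z X} → TE Z X → ∃ λ u → u ∈ Z × u ∈ X
  adjacent-meet conn {Z} {X} zx with private-vertex zx | private-vertex (TE-sym zx)
  ... | x , xX , x∉Z | z , zZ , _ = walk (conn x z) x∉Z (max-right zx) xX ε
    where
    walk : ∀ {y P} → Star Adj y z → y ∉ Z → Max P → y ∈ P → SameBranch Z X P →
           ∃ λ u → u ∈ Z × u ∈ X
    walk ε y∉Z _ _ _ = ⊥-elim (y∉Z zZ)
    walk (_◅_ {j = y′} yy′ s) y∉Z maxP yP XP with edge-maxClique yy′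
    ... | K , maxK , yK , y′K with XP ◅◅ sharing⇒sameBranch y∉Z maxP maxK yP yK | y′ ∈? Z
    ...   | XK | yes y′Z = y′ , y′Z , branch-contains zx y′Z maxK y′K XK
    ...   | XK | no y′∉Z = walk s y′∉Z maxK y′K XK

  module ClawFreeAt (cf : ClawFree G) where
    no-claw : ∀ {a b c d} → Adj a b → Adj a c → Adj a d →
              Independent b c → Independent b d → Independent c d → ⊥
    no-claw ab ac ad (¬bc , b≢c) (¬bd , b≢d) (¬cd , c≢d) =
      cf (_ , _ , _ , _ , ab , ac , ad , b≢c , b≢d , c≢d , ¬bc , ¬bd , ¬cd)

    -- no vertex of Z lies in three distinct neighbours of Z: their private
    -- vertices would form a claw with it
    no-three-neighbours : ∀ {Z X Y W w} → TE Z X → TE Z Y → TE Z W →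
                          X ≢ Y → X ≢ W → Y ≢ W → w ∈ Z → w ∈ X → w ∈ Y → w ∈ W → ⊥
    no-three-neighbours zx zy zw X≢Y X≢W Y≢W wZ wX wY wW
      with private-vertex zx | private-vertex zy | private-vertex zw
    ... | x , xX , x∉Z | y , yY , y∉Z | q , qW , q∉Z =
      no-claw (adj-in (max-right zx) wX xX (∈∉⇒≢ wZ x∉Z))
              (adj-in (max-right zy) wY yY (∈∉⇒≢ wZ y∉Z))
              (adj-in (max-right zw) wW qW (∈∉⇒≢ wZ q∉Z))
              (separated-private zx zy X≢Y xX x∉Z yY y∉Z)
              (separated-private zx zw X≢W xX x∉Z qW q∉Z)
              (separated-private zy zw Y≢W yY y∉Z qW q∉Z)

    -- if w ∈ Z lies in two neighbours X, Y, every vertex of Z lies in X or Y: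
    -- otherwise it forms a claw at w with private vertices of X and Y
    covered-by-pair : ∀ {Z X Y w u} → TE Z X → TE Z Y → X ≢ Y →
                      w ∈ Z → w ∈ X → w ∈ Y → u ∈ Z → u ∈ X ⊎ u ∈ Y
    covered-by-pair {X = X} {Y} {w} {u} zx zy X≢Y wZ wX wY uZ with u ∈? X | u ∈? Y
    ... | yes uX | _ = inj₁ uX
    ... | no _ | yes uY = inj₂ uY
    ... | no u∉X | no u∉Y with private-vertex zx | private-vertex zy
    ...   | x , xX , x∉Z | y , yY , y∉Z =
      ⊥-elim (no-claw (adj-in (max-right zx) wX xX (∈∉⇒≢ wZ x∉Z))
                      (adj-in (max-right zy) wY yY (∈∉⇒≢ wZ y∉Z))
                      (adj-in (max-left zx) wZ uZ (∈∉⇒≢ wX u∉X))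
                      (separated-private zx zy X≢Y xX x∉Z yY y∉Z)
                      (separated-from-Z zx uZ u∉X xX x∉Z)
                      (separated-from-Z zy uZ u∉Y yY y∉Z))

one-avoids : ∀ {A : Set} (_≟_ : DecidableEquality A) {x y z a b : A} → x ≢ y → x ≢ z → y ≢ z →
             (x ≢ a × x ≢ b) ⊎ (y ≢ a × y ≢ b) ⊎ (z ≢ a × z ≢ b)
one-avoids _≟_ {x} {y} {z} {a} {b} x≢y x≢z y≢z with x ≟ a | x ≟ b | y ≟ a | y ≟ b
... | no x≢a | no x≢b | _ | _ = inj₁ (x≢a , x≢b)
... | _ | _ | no y≢a | no y≢b = inj₂ (inj₁ (y≢a , y≢b))
... | yes refl | _ | _ | yes refl = inj₂ (inj₂ (≢-sym x≢z , ≢-sym y≢z))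
... | _ | yes refl | yes refl | _ = inj₂ (inj₂ (≢-sym y≢z , ≢-sym x≢z))
... | yes refl | _ | yes refl | _ = ⊥-elim (x≢y refl)
... | _ | yes refl | _ | yes refl = ⊥-elim (x≢y refl)

module AtClique {n : ℕ} (G : Graph n) (T : CliqueTree G)
                (conn : Connected G) (cf : ClawFree G) (B : Subset n) where
  open CliqueTree T
  open Branches G T
  open ClawFreeAt cf

  -- Let u ∈ B ∩ X ∩ Y with u ∉ W, and t ∈ B ∩ X ∩ W.  Then u lies in no
  -- neighbour X″ ≠ B of X: with private vertices y of Y, x″ of X″, w′ of W
  -- and x ∈ X ∖ X″, one of u and t is the centre of a claw.
  no-further-neighbour : ∀ {X Y W X″ u t} → TE B X → TE B Y → TE B W → X ≢ Y → X ≢ W → Y ≢ W →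
      u ∈ B → u ∈ X → u ∈ Y → u ∉ W → t ∈ B → t ∈ X → t ∈ W →
      TE X X″ → X″ ≢ B → u ∈ X″ → ⊥
  no-further-neighbour {X} {Y} {W} {X″} {u} {t} bx by bw X≢Y X≢W Y≢W uB uX uY u∉W tB tX tW xx″ X″≢B uX″
    with private-vertex by | private-vertex xx″ | private-vertex bw | private-vertex (TE-sym xx″)
  ... | y , yY , y∉B | x″ , x″X″ , x″∉X | w′ , w′W , w′∉B | x , xX , x∉X″ = claw-at-u-or-t
    where
    x″∉B : x″ ∉ B
    x″∉B x″B = x″∉X (shared⇒inside (TE-sym bx) xx″ (≢-sym X″≢B) x″B x″X″)
    X″-beyond-X : SameBranch B X X″
    X″-beyond-X = (xx″ , neighbour-≢ bx , X″≢B) ◅ ε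
    t∉Y : t ∉ Y
    t∉Y tY = no-three-neighbours bx by bw X≢Y X≢W Y≢W tB tX tY tW
    y-x″ : Independent y x″
    y-x″ = separated by bx (≢-sym X≢Y) y∉B (max-right by) yY ε x″∉B (max-right xx″) x″X″ X″-beyond-X
    x″-x : Independent x″ x
    x″-x = separated-from-Z xx″ xX x∉X″ x″X″ x″∉X
    u-y : Graph.Adj G u y
    u-y = adj-in (max-right by) uY yY (∈∉⇒≢ uB y∉B)
    u-x″ : Graph.Adj G u x″
    u-x″ = adj-in (max-right xx″) uX″ x″X″ (∈∉⇒≢ uX x″∉X)
    u-x : Graph.Adj G u x
    u-x = adj-in (max-right bx) uX xX (∈∉⇒≢ uX″ x∉X″)
    claw-at-u-or-t : ⊥
    claw-at-u-or-t with x ∈? B | x ∈? Y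
    ... | no x∉B | _ = no-claw u-y u-x″ u-x y-x″ (separated-private by bx (≢-sym X≢Y) yY y∉B xX x∉B) x″-x
    ... | yes xB | no x∉Y = no-claw u-y u-x″ u-x y-x″ (separated-from-Z by xB x∉Y yY y∉B) x″-x
    ... | yes xB | yes xY with t ∈? X″
    ...   | no t∉X″ =
      no-claw u-y u-x″ (adj-in (max-left bx) uB tB (≢-sym (∈∉⇒≢ tW u∉W)))
              y-x″ (separated-from-Z by tB t∉Y yY y∉B) (separated-from-Z xx″ tX t∉X″ x″X″ x″∉X)
    ...   | yes tX″ =
      no-claw (adj-in (max-right bw) tW w′W (∈∉⇒≢ tB w′∉B))
              (adj-in (max-right xx″) tX″ x″X″ (∈∉⇒≢ tX x″∉X))
              (adj-in (max-left bx) tB xB (∈∉⇒≢ tX″ x∉X″))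
              (separated bw bx (≢-sym X≢W) w′∉B (max-right bw) w′W ε x″∉B (max-right xx″) x″X″ X″-beyond-X)
              (separated-from-Z bw xB x∉W w′W w′∉B)
              x″-x
      where
      x∉W : x ∉ W
      x∉W xW = no-three-neighbours bx by bw X≢Y X≢W Y≢W xB xX xY xW

  -- Hence, in the same situation, no max clique C ≠ X containing u lies in
  -- X's branch: T[M_u] would leave X through some neighbour X″, and X″ = B
  -- is impossible in a tree.
  nothing-beyond : ∀ {X Y W u t C} → TE B X → TE B Y → TE B W → X ≢ Y → X ≢ W → Y ≢ W →
      u ∈ B → u ∈ X → u ∈ Y → u ∉ W → t ∈ B → t ∈ X → t ∈ W →
      Max C → u ∈ C → SameBranch B X C → C ≢ X → ⊥
  nothing-beyond {X} {u = u} {C = C} bx by bw X≢Y X≢W Y≢W uB uX uY u∉W tB tX tW maxC uC XC C≢X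
    with exit proj₁ (running u X C (max-right bx) maxC uX uC) C≢X
  ... | X″ , (xx″ , _ , uX″) , X″C with X″ ≟S B
  ...   | yes refl = branches-exclusive bx XC X″C C≢X
  ...   | no X″≢B = no-further-neighbour bx by bw X≢Y X≢W Y≢W uB uX uY u∉W tB tX tW xx″ X″≢B uX″

  M-exact : ∀ {X Y W u t s} → TE B X → TE B Y → TE B W → X ≢ Y → X ≢ W → Y ≢ W →
      (∀ N → TE B N → N ≡ X ⊎ N ≡ Y ⊎ N ≡ W) →
      u ∈ B → u ∈ X → u ∈ Y → u ∉ W → t ∈ B → t ∈ X → t ∈ W → s ∈ B → s ∈ Y → s ∈ W →
      MvIs G T u B X Y
  M-exact {X} {Y} {u = u} bx by bw X≢Y X≢W Y≢W neighbours uB uX uY u∉W tB tX tW sB sY sW C =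
    ⊆BXY , BXY⊆
    where
    ⊆BXY : Max C × u ∈ C → C ≡ B ⊎ C ≡ X ⊎ C ≡ Y
    ⊆BXY (maxC , uC) with C ≟S B
    ... | yes C≡B = inj₁ C≡B
    ... | no C≢B with exit proj₁ (running u B C (max-left bx) maxC uB uC) C≢B
    ...   | N , (bn , _ , uN) , NC with neighbours N bn
    ...     | inj₂ (inj₂ refl) = ⊥-elim (u∉W uN)
    ...     | inj₁ refl with C ≟S X
    ...       | yes C≡X = inj₂ (inj₁ C≡X)
    ...       | no C≢X = ⊥-elim (nothing-beyond bx by bw X≢Y X≢W Y≢W uB uX uY u∉W tB tX tW maxC uC NC C≢X)
    ⊆BXY (maxC , uC) | no C≢B | N , (bn , _ , uN) , NC | inj₂ (inj₁ refl) with C ≟S Y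
    ...       | yes C≡Y = inj₂ (inj₂ C≡Y)
    ...       | no C≢Y = ⊥-elim (nothing-beyond by bx bw (≢-sym X≢Y) Y≢W X≢W uB uY uX u∉W sB sY sW maxC uC NC C≢Y)
    BXY⊆ : C ≡ B ⊎ C ≡ X ⊎ C ≡ Y → Max C × u ∈ C
    BXY⊆ (inj₁ refl) = max-left bx , uB
    BXY⊆ (inj₂ (inj₁ refl)) = max-right bx , uX
    BXY⊆ (inj₂ (inj₂ refl)) = max-right by , uY

  MvIs-swap : ∀ {v A A′} → MvIs G T v B A A′ → MvIs G T v B A′ A
  MvIs-swap m C = (λ h → swap (proj₁ (m C) h)) , (λ h → proj₂ (m C) (swap h))
    where
    swap : ∀ {P Q R : Set} → P ⊎ Q ⊎ R → P ⊎ R ⊎ Q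
    swap (inj₁ p) = inj₁ p
    swap (inj₂ (inj₁ q)) = inj₂ (inj₂ q)
    swap (inj₂ (inj₂ r)) = inj₂ (inj₁ r)

  module Triangle {X Y W : Subset n} (bx : TE B X) (by : TE B Y) (bw : TE B W)
                  (X≢Y : X ≢ Y) (X≢W : X ≢ W) (Y≢W : Y ≢ W)
                  {pXY pXW pYW : Fin n}
                  (pXY-B : pXY ∈ B) (pXY-X : pXY ∈ X) (pXY-Y : pXY ∈ Y)
                  (pXW-B : pXW ∈ B) (pXW-X : pXW ∈ X) (pXW-W : pXW ∈ W)
                  (pYW-B : pYW ∈ B) (pYW-Y : pYW ∈ Y) (pYW-W : pYW ∈ W) where

    in-two : ∀ {u} → u ∈ B → (u ∈ X × u ∈ Y) ⊎ (u ∈ X × u ∈ W) ⊎ (u ∈ Y × u ∈ W)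
    in-two uB with covered-by-pair bx by X≢Y pXY-B pXY-X pXY-Y uB
    ... | inj₁ uX with covered-by-pair by bw Y≢W pYW-B pYW-Y pYW-W uB
    ...   | inj₁ uY = inj₁ (uX , uY)
    ...   | inj₂ uW = inj₂ (inj₁ (uX , uW))
    in-two uB | inj₂ uY with covered-by-pair bx bw X≢W pXW-B pXW-X pXW-W uB
    ...   | inj₁ uX = inj₁ (uX , uY)
    ...   | inj₂ uW = inj₂ (inj₂ (uY , uW))

    not-in-all : ∀ {u} → u ∈ B → u ∈ X → u ∈ Y → u ∈ W → ⊥
    not-in-all = no-three-neighbours bx by bw X≢Y X≢W Y≢W

    -- a fourth neighbour would meet B in a vertex lying in three neighbours
    only-neighbours : ∀ C → TE B C → C ≡ X ⊎ C ≡ Y ⊎ C ≡ W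
    only-neighbours C bc with C ≟S X | C ≟S Y | C ≟S W
    ... | yes C≡X | _ | _ = inj₁ C≡X
    ... | no _ | yes C≡Y | _ = inj₂ (inj₁ C≡Y)
    ... | no _ | no _ | yes C≡W = inj₂ (inj₂ C≡W)
    ... | no C≢X | no C≢Y | no C≢W with adjacent-meet conn bc
    ...   | u , uB , uC with in-two uB
    ...     | inj₁ (uX , uY) = ⊥-elim (no-three-neighbours bx by bc X≢Y (≢-sym C≢X) (≢-sym C≢Y) uB uX uY uC)
    ...     | inj₂ (inj₁ (uX , uW)) = ⊥-elim (no-three-neighbours bx bw bc X≢W (≢-sym C≢X) (≢-sym C≢W) uB uX uW uC)
    ...     | inj₂ (inj₂ (uY , uW)) = ⊥-elim (no-three-neighbours by bw bc Y≢W (≢-sym C≢Y) (≢-sym C≢W) uB uY uW uC)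

    M-XY : ∀ {u} → u ∈ B → u ∈ X → u ∈ Y → MvIs G T u B X Y
    M-XY uB uX uY = M-exact bx by bw X≢Y X≢W Y≢W only-neighbours uB uX uY (not-in-all uB uX uY)
                      pXW-B pXW-X pXW-W pYW-B pYW-Y pYW-W

    M-XW : ∀ {u} → u ∈ B → u ∈ X → u ∈ W → MvIs G T u B X W
    M-XW uB uX uW = M-exact bx bw by X≢W X≢Y (≢-sym Y≢W) neighbours uB uX uW (λ uY → not-in-all uB uX uY uW)
                      pXY-B pXY-X pXY-Y pYW-B pYW-W pYW-Y
      where
      neighbours : ∀ N → TE B N → N ≡ X ⊎ N ≡ W ⊎ N ≡ Y
      neighbours N bn = [ inj₁ , [ inj₂ ∘ inj₂ , inj₂ ∘ inj₁ ]′ ]′ (only-neighbours N bn)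

    M-YW : ∀ {u} → u ∈ B → u ∈ Y → u ∈ W → MvIs G T u B Y W
    M-YW uB uY uW = M-exact by bw bx Y≢W (≢-sym X≢Y) (≢-sym X≢W) neighbours uB uY uW (λ uX → not-in-all uB uX uY uW)
                      pXY-B pXY-Y pXY-X pXW-B pXW-W pXW-X
      where
      neighbours : ∀ N → TE B N → N ≡ Y ⊎ N ≡ W ⊎ N ≡ X
      neighbours N bn = [ inj₂ ∘ inj₂ , [ inj₁ , inj₂ ∘ inj₁ ]′ ]′ (only-neighbours N bn)

    each-vertex-in-two : ∀ v → v ∈ B → ∃[ A ] ∃[ A′ ] (TE B A × TE B A′ × A ≢ A′ × MvIs G T v B A A′)
    each-vertex-in-two v vB with in-two vB
    ... | inj₁ (vX , vY) = X , Y , bx , by , X≢Y , M-XY vB vX vY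
    ... | inj₂ (inj₁ (vX , vW)) = X , W , bx , bw , X≢W , M-XW vB vX vW
    ... | inj₂ (inj₂ (vY , vW)) = Y , W , by , bw , Y≢W , M-YW vB vY vW

    each-pair-shared : ∀ A A′ → TE B A → TE B A′ → A ≢ A′ → ∃[ v ] (v ∈ B × MvIs G T v B A A′)
    each-pair-shared A A′ ba ba′ A≢A′ with only-neighbours A ba | only-neighbours A′ ba′
    ... | inj₁ refl | inj₁ refl = ⊥-elim (A≢A′ refl)
    ... | inj₂ (inj₁ refl) | inj₂ (inj₁ refl) = ⊥-elim (A≢A′ refl)
    ... | inj₂ (inj₂ refl) | inj₂ (inj₂ refl) = ⊥-elim (A≢A′ refl)
    ... | inj₁ refl | inj₂ (inj₁ refl) = pXY , pXY-B , M-XY pXY-B pXY-X pXY-Y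
    ... | inj₁ refl | inj₂ (inj₂ refl) = pXW , pXW-B , M-XW pXW-B pXW-X pXW-W
    ... | inj₂ (inj₁ refl) | inj₂ (inj₂ refl) = pYW , pYW-B , M-YW pYW-B pYW-Y pYW-W
    ... | inj₂ (inj₁ refl) | inj₁ refl = pXY , pXY-B , MvIs-swap (M-XY pXY-B pXY-X pXY-Y)
    ... | inj₂ (inj₂ refl) | inj₁ refl = pXW , pXW-B , MvIs-swap (M-XW pXW-B pXW-X pXW-W)
    ... | inj₂ (inj₂ refl) | inj₂ (inj₁ refl) = pYW , pYW-B , MvIs-swap (M-YW pYW-B pYW-Y pYW-W)

    fork : IsForkClique G T B
    fork = (X , Y , W , bx , by , bw , X≢Y , X≢W , Y≢W , only-neighbours) ,
           each-vertex-in-two , each-pair-shared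

  -- A vertex v ∈ B ∩ A ∩ A′ and a vertex u ∈ B ∩ A ∩ D for a third
  -- neighbour D give a triangle: a vertex b ∈ B ∖ A lies in A′ and in D.
  fork-from-two-shared : ∀ {A A′ D v u} → TE B A → TE B A′ → TE B D → A ≢ A′ → D ≢ A → D ≢ A′ →
                         v ∈ B → v ∈ A → v ∈ A′ → u ∈ B → u ∈ A → u ∈ D → IsForkClique G T B
  fork-from-two-shared {A} {A′} {D} ba ba′ bd A≢A′ D≢A D≢A′ vB vA vA′ uB uA uD with private-vertex (TE-sym ba)
  ... | b , bB , b∉A = Triangle.fork ba ba′ bd A≢A′ (≢-sym D≢A) (≢-sym D≢A′)
                         vB vA vA′ uB uA uD bB bA′ bD
    where
    bA′ : b ∈ A′
    bA′ = [ (λ bA → ⊥-elim (b∉A bA)) , id ]′ (covered-by-pair ba ba′ A≢A′ vB vA vA′ bB)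
    bD : b ∈ D
    bD = [ id , (λ bA → ⊥-elim (b∉A bA)) ]′ (covered-by-pair bd ba D≢A uB uD uA bB)

  third-neighbour : DegAtLeast3 G T B → ∀ A A′ → ∃ λ D → TE B D × D ≢ A × D ≢ A′
  third-neighbour (A₁ , A₂ , A₃ , t₁ , t₂ , t₃ , d₁₂ , d₁₃ , d₂₃) A A′
    with one-avoids _≟S_ {a = A} {b = A′} d₁₂ d₁₃ d₂₃
  ... | inj₁ (D≢A , D≢A′) = A₁ , t₁ , D≢A , D≢A′
  ... | inj₂ (inj₁ (D≢A , D≢A′)) = A₂ , t₂ , D≢A , D≢A′
  ... | inj₂ (inj₂ (D≢A , D≢A′)) = A₃ , t₃ , D≢A , D≢A′

  -- a vertex of B in two distinct neighbours makes B a fork clique: a third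
  -- neighbour D meets B in a vertex lying in A or A′
  fork-from-shared : ∀ {A A′ v} → DegAtLeast3 G T B → TE B A → TE B A′ → A ≢ A′ →
                     v ∈ B → v ∈ A → v ∈ A′ → IsForkClique G T B
  fork-from-shared {A} {A′} deg ba ba′ A≢A′ vB vA vA′ with third-neighbour deg A A′
  ... | D , bd , D≢A , D≢A′ with adjacent-meet conn bd
  ...   | u , uB , uD with covered-by-pair ba ba′ A≢A′ vB vA vA′ uB
  ...     | inj₁ uA = fork-from-two-shared ba ba′ bd A≢A′ D≢A D≢A′ vB vA vA′ uB uA uD
  ...     | inj₂ uA′ = fork-from-two-shared ba′ ba bd (≢-sym A≢A′) D≢A′ D≢A vB vA′ vA uB uA′ uD

  star-or-fork : DegAtLeast3 G T B → IsStarClique G T B ⊎ IsForkClique G T B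
  star-or-fork deg@(A₁ , A₂ , _ , t₁ , t₂ , _ , d₁₂ , _) with any? (λ v → (v ∈? B) ×-dec ((v ∈? A₁) ×-dec (v ∈? A₂)))
  ... | yes (v , vB , vA₁ , vA₂) = inj₂ (fork-from-shared deg t₁ t₂ d₁₂ vB vA₁ vA₂)
  ... | no none = inj₁ λ v vB → vB , at-most-one v vB
    where
    -- a vertex of B in two neighbours would make B a fork clique, which has
    -- a vertex of B in A₁ and A₂
    at-most-one : ∀ v → v ∈ B → ∀ A A′ → TE B A → TE B A′ → v ∈ A → v ∈ A′ → A ≡ A′
    at-most-one v vB A A′ ba ba′ vA vA′ with A ≟S A′
    ... | yes A≡A′ = A≡A′
    ... | no A≢A′ with proj₂ (proj₂ (fork-from-shared deg ba ba′ A≢A′ vB vA vA′)) A₁ A₂ t₁ t₂ d₁₂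
    ...   | w , wB , M-w = ⊥-elim (none (w , wB , proj₂ (proj₂ (M-w A₁) (inj₂ (inj₁ refl))) ,
                                                 proj₂ (proj₂ (M-w A₂) (inj₂ (inj₂ refl)))))

lemma3p7 : ∀ {n : ℕ} (G : Graph n) → Connected G → Chordal G → ClawFree G →
           (T : CliqueTree G) → (B : Subset n) → IsMaxClique G B →
           DegAtLeast3 G T B → IsStarClique G T B ⊎ IsForkClique G T B
lemma3p7 G conn _ cf T B _ = AtClique.star-or-fork G T conn cf B
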